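{- Let $T$ be a numerical set. There exists a numerical semigroup $S$ with $T=\widetilde{S}$ if and only if both of the following hold: (a) $F(T)\notin T+T=\{x+y\mid x,y\in T\}$; (b) for all $x,y\in T\cap[0,F(T)]$ with $x+y>F(T)$, we have $x+y-F(T)-1\in T$.
   Context: $\mathbb{N}=\{0,1,2,\dots\}$. A numerical set is a subset $S\subseteq\mathbb{N}$ with $0\in S$ and $\mathbb{N}\setminus S$ finite. Its gaps are the elements of $\mathbb{N}\setminus S$, and $F(S)$ is the largest gap, with $F(\mathbb{N})=-1$. A numerical semigroup is a numerical set closed under addition. For $S\neq\mathbb{N}$, the base is $B(S)=\max\{s\in S\mid s<F(S)\}$. Young diagram of $S$: it has one left-justified row for each gap $\ell$. The top row corresponds to $F(S)$, and the gaps decrease going down. The row for $\ell$ has length $|\{s\in S\mid s<\ell\}|$. This is a bijection between numerical sets and Young diagrams, with $\mathbb{N}$ corresponding to the empty diagram. The complement of a Young diagram with row lengths $\lambda_1\ge\dots\ge\lambda_g$ has row lengths $\lambda_1-\lambda_g\ge\dots\ge\lambda_1-\lambda_1$, zero rows being discarded. Geometrically, this is the rest of the $g\times\lambda_1$ rectangle rotated by $180^\circ$. The complement $\widetilde{S}$ of a numerical set $S$ is the numerical set whose Young diagram is the complement of that of $S$. One has $\widetilde{\mathbb{N}}=\mathbb{N}$, and for $S\neq\mathbb{N}$ equivalently $\widetilde{S}=\{B(S)-s\mid s\in S,\ s\le B(S)\}\cup\{n\mid n\ge B(S)\}$. -}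

module Defs where

open import Data.Bool using (Bool; true; false; not; _∧_; _∨_)
open import Data.Nat using (ℕ; zero; suc; _+_; _∸_; _≤_; _<_; _≤ᵇ_)
open import Data.Maybe using (Maybe; just; nothing)
open import Data.Product using (Σ; _×_; ∃)
open import Relation.Binary.PropositionalEquality using (_≡_)
open import Relation.Nullary using (¬_)
open import Function.Bundles using (_⇔_)

record NumericalSet : Set where
  field
    mem    : ℕ → Bool
    zero∈  : mem 0 ≡ true
    bound  : ℕ
    cofin  : ∀ n → bound ≤ n → mem n ≡ true
open NumericalSet public

_∈ₙ_ : ℕ → NumericalSet → Set
n ∈ₙ S = mem S n ≡ true

maxBelow : (ℕ → Bool) → ℕ → Maybe ℕ
maxBelow p zero    = nothing
maxBelow p (suc n) with p n
... | true  = just n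
... | false = maxBelow p n

-- Frobenius number F(S): `just f` = the largest gap f; `nothing` encodes F(ℕ) = -1.
frobenius : NumericalSet → Maybe ℕ
frobenius S = maxBelow (λ n → not (mem S n)) (bound S)

base : NumericalSet → Maybe ℕ
base S with frobenius S
... | nothing = nothing
... | just f  = maxBelow (mem S) f

-- Membership in the complement S̃:
--   S̃ = ℕ if S = ℕ,
--   S̃ = {B - s | s ∈ S, s ≤ B} ∪ {n | n ≥ B} with B = B(S) otherwise.
complMem : NumericalSet → ℕ → Bool
complMem S n with frobenius S
... | nothing = mem S n
... | just _ with base S
...   | nothing = true   -- impossible case (0 ∈ S lies below F(S) > 0)
...   | just b  = (b ≤ᵇ n) ∨ ((n ≤ᵇ b) ∧ mem S (b ∸ n))

_≐compl_ : NumericalSet → NumericalSet → Set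
T ≐compl S = ∀ n → mem T n ≡ complMem S n

IsNumericalSemigroup : NumericalSet → Set
IsNumericalSemigroup S = ∀ x y → x ∈ₙ S → y ∈ₙ S → (x + y) ∈ₙ S

CondA : NumericalSet → Set
CondA T = ∀ f → frobenius T ≡ just f →
  ¬ (Σ ℕ λ x → Σ ℕ λ y → x ∈ₙ T × y ∈ₙ T × x + y ≡ f)

CondB : NumericalSet → Set
CondB T = ∀ f → frobenius T ≡ just f →
  ∀ x y → x ∈ₙ T → y ∈ₙ T → x ≤ f → y ≤ f → f < x + y →
  (x + y ∸ f ∸ 1) ∈ₙ T

-- Write b = B(S). For x ≤ b the complement reflects membership, x ∈ S̃ ⇔ b − x ∈ S, and it
-- turns a sum x + y into (b − x) + (b − y) = 2b − (x + y). If S is a semigroup then 1 ∉ S,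
-- which forces b = F(S̃) + 1; closure of S under (b − x) + (b − y) then yields (b), and since
-- b + 1 ∉ S it excludes x + y = F(S̃), which is (a). Conversely, for f = F(T) the set
-- {f + 1 − t | t ∈ T, t ≤ f + 1} ∪ [f + 3, ∞) has complement T, and (a) and (b) are exactly
-- what it needs to be closed under addition.
module Submission where

open import Data.Bool using (Bool; true; false; not; _∧_; _∨_)
open import Data.Bool.Properties using (∨-identityʳ; ∨-zeroʳ; not-injective; not-¬)
open import Data.Empty using (⊥-elim)
open import Data.Maybe using (just; nothing)
open import Data.Nat
open import Data.Nat.Properties
open import Algebra.Properties.CommutativeSemigroup +-commutativeSemigroup using (interchange)
open import Data.Product using (Σ; ∃; ∃₂; _×_; _,_; proj₁; proj₂)
open import Data.Sum using (_⊎_; inj₁; inj₂)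
open import Function.Bundles using (_⇔_; mk⇔)
open import Relation.Binary.Definitions using (tri<; tri≈; tri>)
open import Relation.Binary.PropositionalEquality
open import Relation.Nullary using (¬_; yes; no)
open import Relation.Nullary.Reflects using (ofʸ; ofⁿ)

open import Defs

≤⇒≤ᵇ≡true : ∀ {m n} → m ≤ n → (m ≤ᵇ n) ≡ true
≤⇒≤ᵇ≡true {m} {n} m≤n with m ≤ᵇ n | ≤ᵇ-reflects-≤ m n
... | true  | _       = refl
... | false | ofⁿ m≰n = ⊥-elim (m≰n m≤n)

>⇒≤ᵇ≡false : ∀ {m n} → n < m → (m ≤ᵇ n) ≡ false
>⇒≤ᵇ≡false {m} {n} n<m with m ≤ᵇ n | ≤ᵇ-reflects-≤ m n
... | true  | ofʸ m≤n = ⊥-elim (<⇒≱ n<m m≤n)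
... | false | _       = refl

m∸n∸1≡m∸[1+n] : ∀ m n → m ∸ n ∸ 1 ≡ m ∸ suc n
m∸n∸1≡m∸[1+n] m n = trans (∸-+-assoc m n 1) (cong (m ∸_) (+-comm n 1))

complements-sum : ∀ {b} u v x y → u + x ≡ b → v + y ≡ b → (u + v) + (x + y) ≡ b + b
complements-sum u v x y p q = trans (interchange u v x y) (cong₂ _+_ p q)

record IsMaxBelow (p : ℕ → Bool) (n k : ℕ) : Set where
  field
    holds   : p k ≡ true
    below   : k < n
    maximal : ∀ {j} → k < j → j < n → p j ≡ false

IsMaxBelow-unique : ∀ {p n k m} → IsMaxBelow p n k → IsMaxBelow p n m → k ≡ m
IsMaxBelow-unique {k = k} {m} K M with <-cmp k m
... | tri< k<m _ _ = ⊥-elim (not-¬ (IsMaxBelow.holds M) (IsMaxBelow.maximal K k<m (IsMaxBelow.below M)))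
... | tri≈ _ k≡m _ = k≡m
... | tri> _ _ m<k = ⊥-elim (not-¬ (IsMaxBelow.holds K) (IsMaxBelow.maximal M m<k (IsMaxBelow.below K)))

maxBelow-sound : ∀ p n {k} → maxBelow p n ≡ just k → IsMaxBelow p n k
maxBelow-sound p (suc n) e with p n in pn
maxBelow-sound p (suc n) refl | true = record
  { holds = pn ; below = n<1+n n ; maximal = λ n<j j≤n → ⊥-elim (<⇒≱ n<j (≤-pred j≤n)) }
maxBelow-sound p (suc n) e | false = record
  { holds = holds ; below = m<n⇒m<1+n below ; maximal = maximal′ }
  where
  open IsMaxBelow (maxBelow-sound p n e)
  maximal′ : ∀ {j} → _ < j → j < suc n → p j ≡ false
  maximal′ k<j j<1+n with m≤n⇒m<n∨m≡n (≤-pred j<1+n)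
  ... | inj₁ j<n  = maximal k<j j<n
  ... | inj₂ refl = pn

maxBelow-nothing : ∀ p n → maxBelow p n ≡ nothing → ∀ {j} → j < n → p j ≡ false
maxBelow-nothing p (suc n) e j<1+n with p n in pn
maxBelow-nothing p (suc n) e j<1+n | false with m≤n⇒m<n∨m≡n (≤-pred j<1+n)
... | inj₁ j<n  = maxBelow-nothing p n e j<n
... | inj₂ refl = pn

maxBelow-defined : ∀ p n {k} → p k ≡ true → k < n → ∃ λ m → maxBelow p n ≡ just m
maxBelow-defined p n pk k<n with maxBelow p n in e
... | just m  = m , refl
... | nothing = ⊥-elim (not-¬ pk (maxBelow-nothing p n e k<n))

maxBelow-complete : ∀ p n {k} → IsMaxBelow p n k → maxBelow p n ≡ just k
maxBelow-complete p n K with maxBelow-defined p n (IsMaxBelow.holds K) (IsMaxBelow.below K)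
... | m , e = trans e (cong just (IsMaxBelow-unique (maxBelow-sound p n e) K))

isGap : NumericalSet → ℕ → Bool
isGap S n = not (mem S n)

module _ (S : NumericalSet) where

  frobenius-gap : ∀ {f} → frobenius S ≡ just f → mem S f ≡ false
  frobenius-gap e = not-injective (IsMaxBelow.holds (maxBelow-sound (isGap S) (bound S) e))

  frobenius-above : ∀ {f n} → frobenius S ≡ just f → f < n → n ∈ₙ S
  frobenius-above {n = n} e f<n with n <? bound S
  ... | yes n<B = not-injective (IsMaxBelow.maximal (maxBelow-sound (isGap S) (bound S) e) f<n n<B)
  ... | no  n≮B = cofin S n (≮⇒≥ n≮B)

  frobenius-nothing : ∀ {n} → frobenius S ≡ nothing → n ∈ₙ S
  frobenius-nothing {n} e with n <? bound S
  ... | yes n<B = not-injective (maxBelow-nothing (isGap S) (bound S) e n<B)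
  ... | no  n≮B = cofin S n (≮⇒≥ n≮B)

  frobenius-complete : ∀ {f} → mem S f ≡ false → (∀ {n} → f < n → n ∈ₙ S) → frobenius S ≡ just f
  frobenius-complete {f} f∉S above = maxBelow-complete (isGap S) (bound S) record
    { holds   = cong not f∉S
    ; below   = ≰⇒> λ B≤f → not-¬ (cofin S f B≤f) f∉S
    ; maximal = λ f<j _ → cong not (above f<j)
    }

  frobenius-positive : ∀ {g} → frobenius S ≡ just g → 0 < g
  frobenius-positive {zero}  e = ⊥-elim (not-¬ (zero∈ S) (frobenius-gap e))
  frobenius-positive {suc g} e = z<s

  base-unfold : ∀ {g} → frobenius S ≡ just g → base S ≡ maxBelow (mem S) g
  base-unfold e with frobenius S | e
  ... | just g | refl = refl

  base-defined : ∀ {g} → frobenius S ≡ just g → ∃ λ b → base S ≡ just b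
  base-defined {g} e with maxBelow-defined (mem S) g (zero∈ S) (frobenius-positive e)
  ... | b , e′ = b , trans (base-unfold e) e′

  base-sound : ∀ {g b} → frobenius S ≡ just g → base S ≡ just b → IsMaxBelow (mem S) g b
  base-sound {g} e e′ = maxBelow-sound (mem S) g (trans (sym (base-unfold e)) e′)

  base-complete : ∀ {g b} → frobenius S ≡ just g → IsMaxBelow (mem S) g b → base S ≡ just b
  base-complete {g} e B = trans (base-unfold e) (maxBelow-complete (mem S) g B)

  suc-base∉ : ∀ {g b} → frobenius S ≡ just g → base S ≡ just b → mem S (suc b) ≡ false
  suc-base∉ e e′ with m≤n⇒m<n∨m≡n (IsMaxBelow.below (base-sound e e′))
  ... | inj₁ 1+b<g = IsMaxBelow.maximal (base-sound e e′) (n<1+n _) 1+b<g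
  ... | inj₂ refl  = frobenius-gap e

  complMem-ℕ : ∀ n → frobenius S ≡ nothing → complMem S n ≡ mem S n
  complMem-ℕ n e with frobenius S | e
  ... | nothing | refl = refl

  complMem-unfold : ∀ {g b} n → frobenius S ≡ just g → base S ≡ just b →
    complMem S n ≡ ((b ≤ᵇ n) ∨ ((n ≤ᵇ b) ∧ mem S (b ∸ n)))
  complMem-unfold n e e′ with frobenius S in e″ | e
  ... | just g | refl with maxBelow (isGap S) (bound S) | e″
  ...   | just g | refl with maxBelow (mem S) g | e′
  ...     | just _ | refl = refl

  complMem-≥base : ∀ {g b n} → frobenius S ≡ just g → base S ≡ just b → b ≤ n → complMem S n ≡ true
  complMem-≥base {n = n} e e′ b≤n rewrite complMem-unfold n e e′ | ≤⇒≤ᵇ≡true b≤n = refl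

  complMem-≤base : ∀ {g b n} → frobenius S ≡ just g → base S ≡ just b → n ≤ b →
    complMem S n ≡ mem S (b ∸ n)
  complMem-≤base {b = b} {n} e e′ n≤b with m≤n⇒m<n∨m≡n n≤b
  ... | inj₁ n<b rewrite complMem-unfold n e e′ | >⇒≤ᵇ≡false n<b | ≤⇒≤ᵇ≡true n≤b = refl
  ... | inj₂ refl = trans (complMem-≥base e e′ ≤-refl) (sym (trans (cong (mem S) (n∸n≡0 b)) (zero∈ S)))

-- The complement of a numerical semigroup

1∈⇒all∈ : ∀ {S} → IsNumericalSemigroup S → 1 ∈ₙ S → ∀ n → n ∈ₙ S
1∈⇒all∈ {S} closed 1∈S zero    = zero∈ S
1∈⇒all∈ {S} closed 1∈S (suc n) = closed 1 n 1∈S (1∈⇒all∈ {S} closed 1∈S n)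

complement-has-gap⇒base-defined : ∀ {S T f} → T ≐compl S → frobenius T ≡ just f →
  ∃₂ λ g b → frobenius S ≡ just g × base S ≡ just b
complement-has-gap⇒base-defined {S} {T} {f} T≐S frobT = cases (frobenius S) refl
  where
  cases : ∀ m → frobenius S ≡ m → ∃₂ λ g b → frobenius S ≡ just g × base S ≡ just b
  cases (just g) frobS = g , base-defined S frobS .proj₁ , frobS , base-defined S frobS .proj₂
  cases nothing  frobS = ⊥-elim (not-¬ f∈T (frobenius-gap T frobT))
    where
    f∈T : f ∈ₙ T
    f∈T = trans (T≐S f) (trans (complMem-ℕ S f frobS) (frobenius-nothing S frobS))

module ComplementOfSemigroup
  {S T : NumericalSet} (closed : IsNumericalSemigroup S) (T≐S : T ≐compl S)
  {g b} (frobS : frobenius S ≡ just g) (baseS : base S ≡ just b)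
  {f} (frobT : frobenius T ≡ just f) where

  ≥base∈T : ∀ {n} → b ≤ n → n ∈ₙ T
  ≥base∈T b≤n = trans (T≐S _) (complMem-≥base S frobS baseS b≤n)

  ≤base-mirror : ∀ {n} → n ≤ b → mem T n ≡ mem S (b ∸ n)
  ≤base-mirror n≤b = trans (T≐S _) (complMem-≤base S frobS baseS n≤b)

  base≡suc-frobenius : b ≡ suc f
  base≡suc-frobenius = ≤-antisym (≮⇒≥ 1+f≮b) f<b
    where
    f<b : f < b
    f<b = ≰⇒> λ b≤f → not-¬ (≥base∈T b≤f) (frobenius-gap T frobT)
    -- b − 1 > F(T) would lie in T, putting b − (b − 1) = 1 in S
    1+f≮b : ¬ suc f < b
    1+f≮b (s≤s {n = b′} f<b′) = not-¬ (1∈⇒all∈ {S} closed 1∈S g) (frobenius-gap S frobS)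
      where
      1∈S : 1 ∈ₙ S
      1∈S = trans (cong (mem S) (sym (m+n∸n≡m 1 b′)))
              (trans (sym (≤base-mirror (n≤1+n b′))) (frobenius-above T frobT f<b′))

  ≤frobenius⇒≤base : ∀ {x} → x ≤ f → x ≤ b
  ≤frobenius⇒≤base x≤f = subst (_ ≤_) (sym base≡suc-frobenius) (m≤n⇒m≤1+n x≤f)

  mirrored-sum : ∀ {x y} → x ∈ₙ T → y ∈ₙ T → x ≤ f → y ≤ f →
    ((b ∸ x) + (b ∸ y)) ∈ₙ S × ((b ∸ x) + (b ∸ y)) + (x + y) ≡ b + b
  mirrored-sum {x} {y} x∈T y∈T x≤f y≤f =
    closed _ _ (∈T⇒mirror∈S x∈T (≤frobenius⇒≤base x≤f)) (∈T⇒mirror∈S y∈T (≤frobenius⇒≤base y≤f)) ,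
    complements-sum (b ∸ x) (b ∸ y) x y (m∸n+n≡m (≤frobenius⇒≤base x≤f)) (m∸n+n≡m (≤frobenius⇒≤base y≤f))
    where
    ∈T⇒mirror∈S : ∀ {x} → x ∈ₙ T → x ≤ b → (b ∸ x) ∈ₙ S
    ∈T⇒mirror∈S x∈T x≤b = trans (sym (≤base-mirror x≤b)) x∈T

  condA : ¬ (Σ ℕ λ x → Σ ℕ λ y → x ∈ₙ T × y ∈ₙ T × x + y ≡ f)
  condA (x , y , x∈T , y∈T , x+y≡f) = not-¬ (subst (_∈ₙ S) P≡1+b P∈S) (suc-base∉ S frobS baseS)
    where
    open ≡-Reasoning
    x≤f : x ≤ f
    x≤f = subst (x ≤_) x+y≡f (m≤m+n x y)
    y≤f : y ≤ f
    y≤f = subst (y ≤_) x+y≡f (m≤n+m y x)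
    P : ℕ
    P = (b ∸ x) + (b ∸ y)
    P∈S : P ∈ₙ S
    P∈S = mirrored-sum x∈T y∈T x≤f y≤f .proj₁
    P≡1+b : P ≡ suc b
    P≡1+b = +-cancelʳ-≡ f P (suc b) (begin
      P + f         ≡⟨ cong (P +_) x+y≡f ⟨
      P + (x + y)   ≡⟨ mirrored-sum x∈T y∈T x≤f y≤f .proj₂ ⟩
      b + b         ≡⟨ cong (b +_) base≡suc-frobenius ⟩
      b + suc f     ≡⟨ +-suc b f ⟩
      suc b + f     ∎)

  condB : ∀ x y → x ∈ₙ T → y ∈ₙ T → x ≤ f → y ≤ f → f < x + y → (x + y ∸ f ∸ 1) ∈ₙ T
  condB x y x∈T y∈T x≤f y≤f f<x+y = subst (_∈ₙ T) n≡x+y∸f∸1 n∈T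
    where
    open ≡-Reasoning
    b≤x+y : b ≤ x + y
    b≤x+y = subst (_≤ x + y) (sym base≡suc-frobenius) f<x+y
    n : ℕ
    n = x + y ∸ b
    n≡x+y∸f∸1 : n ≡ x + y ∸ f ∸ 1
    n≡x+y∸f∸1 = sym (trans (m∸n∸1≡m∸[1+n] (x + y) f) (cong (x + y ∸_) (sym base≡suc-frobenius)))
    P : ℕ
    P = (b ∸ x) + (b ∸ y)
    P+n≡b : P + n ≡ b
    P+n≡b = +-cancelʳ-≡ b (P + n) b (begin
      (P + n) + b   ≡⟨ +-assoc P n b ⟩
      P + (n + b)   ≡⟨ cong (P +_) (m∸n+n≡m b≤x+y) ⟩
      P + (x + y)   ≡⟨ mirrored-sum x∈T y∈T x≤f y≤f .proj₂ ⟩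
      b + b         ∎)
    n∈T : n ∈ₙ T
    n∈T = trans (≤base-mirror (subst (n ≤_) P+n≡b (m≤n+m n P)))
            (subst (_∈ₙ S) (trans (sym (m+n∸n≡m P n)) (cong (_∸ n) P+n≡b))
              (mirrored-sum x∈T y∈T x≤f y≤f .proj₁))

semigroup-complement⇒conditions : ∀ T →
  (Σ NumericalSet λ S → IsNumericalSemigroup S × (T ≐compl S)) → CondA T × CondB T
semigroup-complement⇒conditions T (S , closed , T≐S) =
  (λ f frobT → let (_ , _ , frobS , baseS) = complement-has-gap⇒base-defined {S} {T} T≐S frobT
               in ComplementOfSemigroup.condA {S} {T} closed T≐S frobS baseS frobT) ,
  (λ f frobT → let (_ , _ , frobS , baseS) = complement-has-gap⇒base-defined {S} {T} T≐S frobT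
               in ComplementOfSemigroup.condB {S} {T} closed T≐S frobS baseS frobT)

-- Reflecting a numerical set at b

mirrorMem : NumericalSet → ℕ → ℕ → Bool
mirrorMem T b n = ((n ≤ᵇ b) ∧ mem T (b ∸ n)) ∨ (2 + b ≤ᵇ n)

module _ (T : NumericalSet) (b : ℕ) where

  mirrorMem-≤ : ∀ {n} → n ≤ b → mirrorMem T b n ≡ mem T (b ∸ n)
  mirrorMem-≤ {n} n≤b rewrite ≤⇒≤ᵇ≡true n≤b | >⇒≤ᵇ≡false (s≤s (m≤n⇒m≤1+n n≤b)) =
    ∨-identityʳ (mem T (b ∸ n))

  mirrorMem-1+b : mirrorMem T b (suc b) ≡ false
  mirrorMem-1+b rewrite >⇒≤ᵇ≡false (n<1+n b) = refl

  mirrorMem-≥ : ∀ {n} → 2 + b ≤ n → mirrorMem T b n ≡ true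
  mirrorMem-≥ {n} 2+b≤n rewrite ≤⇒≤ᵇ≡true 2+b≤n = ∨-zeroʳ _

  mirrorMem-true : ∀ {n} → mirrorMem T b n ≡ true → (n ≤ b × (b ∸ n) ∈ₙ T) ⊎ 2 + b ≤ n
  mirrorMem-true {n} n∈ with <-cmp n (suc b)
  ... | tri< n<1+b _ _ = inj₁ (≤-pred n<1+b , trans (sym (mirrorMem-≤ (≤-pred n<1+b))) n∈)
  ... | tri≈ _ refl _  = ⊥-elim (not-¬ n∈ mirrorMem-1+b)
  ... | tri> _ _ 1+b<n = inj₂ 1+b<n

mirror : (T : NumericalSet) (b : ℕ) → b ∈ₙ T → NumericalSet
mirror T b b∈T = record
  { mem   = mirrorMem T b
  ; zero∈ = trans (mirrorMem-≤ T b z≤n) b∈T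
  ; bound = 2 + b
  ; cofin = λ _ → mirrorMem-≥ T b
  }

module _ (T : NumericalSet) (b : ℕ) (b∈T : b ∈ₙ T) where

  frobenius-mirror : frobenius (mirror T b b∈T) ≡ just (suc b)
  frobenius-mirror = frobenius-complete (mirror T b b∈T) (mirrorMem-1+b T b) (mirrorMem-≥ T b)

  base-mirror : base (mirror T b b∈T) ≡ just b
  base-mirror = base-complete (mirror T b b∈T) frobenius-mirror record
    { holds   = trans (mirrorMem-≤ T b ≤-refl) (trans (cong (mem T) (n∸n≡0 b)) (zero∈ T))
    ; below   = n<1+n b
    ; maximal = λ b<j j<1+b → ⊥-elim (<⇒≱ b<j (≤-pred j<1+b))
    }

  complement-mirror : (∀ {n} → b ≤ n → n ∈ₙ T) → T ≐compl mirror T b b∈T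
  complement-mirror ≥b∈T n with ≤-total n b
  ... | inj₂ b≤n = trans (≥b∈T b≤n) (sym (complMem-≥base (mirror T b b∈T) frobenius-mirror base-mirror b≤n))
  ... | inj₁ n≤b = sym (begin
    complMem (mirror T b b∈T) n  ≡⟨ complMem-≤base (mirror T b b∈T) frobenius-mirror base-mirror n≤b ⟩
    mirrorMem T b (b ∸ n)        ≡⟨ mirrorMem-≤ T b (m∸n≤m b n) ⟩
    mem T (b ∸ (b ∸ n))          ≡⟨ cong (mem T) (m∸[m∸n]≡n n≤b) ⟩
    mem T n                      ∎)
    where open ≡-Reasoning

-- The semigroup whose complement is T

module MirrorAtFrobenius
  {T : NumericalSet} {f : ℕ} (frobT : frobenius T ≡ just f) (condA : CondA T) (condB : CondB T) where

  b : ℕ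
  b = suc f

  S : NumericalSet
  S = mirror T b (frobenius-above T frobT (n<1+n f))

  complement : T ≐compl S
  complement = complement-mirror T b _ (frobenius-above T frobT)

  module SmallSummands {x y} (x≤b : x ≤ b) (y≤b : y ≤ b)
    (b∸x∈T : (b ∸ x) ∈ₙ T) (b∸y∈T : (b ∸ y) ∈ₙ T) (b∸x≤f : b ∸ x ≤ f) (b∸y≤f : b ∸ y ≤ f) where
    open ≡-Reasoning

    P : ℕ
    P = (b ∸ x) + (b ∸ y)

    P+[x+y]≡b+b : P + (x + y) ≡ b + b
    P+[x+y]≡b+b = complements-sum (b ∸ x) (b ∸ y) x y (m∸n+n≡m x≤b) (m∸n+n≡m y≤b)

    sum≢1+b : x + y ≢ suc b
    sum≢1+b x+y≡1+b = condA f frobT (b ∸ x , b ∸ y , b∸x∈T , b∸y∈T , P≡f)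
      where
      P≡f : P ≡ f
      P≡f = +-cancelʳ-≡ (suc b) P f (begin
        P + suc b    ≡⟨ cong (P +_) x+y≡1+b ⟨
        P + (x + y)  ≡⟨ P+[x+y]≡b+b ⟩
        b + b        ≡⟨ +-suc f b ⟨
        f + suc b    ∎)

    sum≤b⇒∈S : x + y ≤ b → (x + y) ∈ₙ S
    sum≤b⇒∈S x+y≤b = trans (mirrorMem-≤ T b x+y≤b)
      (subst (_∈ₙ T) P∸f∸1≡w (condB f frobT _ _ b∸x∈T b∸y∈T b∸x≤f b∸y≤f f<P))
      where
      w : ℕ
      w = b ∸ (x + y)
      P≡w+b : P ≡ w + b
      P≡w+b = +-cancelʳ-≡ (x + y) P (w + b) (begin
        P + (x + y)        ≡⟨ P+[x+y]≡b+b ⟩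
        b + b              ≡⟨ cong (_+ b) (m∸n+n≡m x+y≤b) ⟨
        (w + (x + y)) + b  ≡⟨ +-assoc w (x + y) b ⟩
        w + ((x + y) + b)  ≡⟨ cong (w +_) (+-comm (x + y) b) ⟩
        w + (b + (x + y))  ≡⟨ +-assoc w b (x + y) ⟨
        (w + b) + (x + y)  ∎)
      f<P : f < P
      f<P = subst (f <_) (sym P≡w+b) (m≤n+m b w)
      P∸f∸1≡w : P ∸ f ∸ 1 ≡ w
      P∸f∸1≡w = trans (m∸n∸1≡m∸[1+n] P f) (trans (cong (_∸ b) P≡w+b) (m+n∸n≡m w b))

    sum∈S : (x + y) ∈ₙ S
    sum∈S with <-cmp (x + y) (suc b)
    ... | tri< x+y<1+b _ _ = sum≤b⇒∈S (≤-pred x+y<1+b)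
    ... | tri≈ _ x+y≡1+b _ = ⊥-elim (sum≢1+b x+y≡1+b)
    ... | tri> _ _ 1+b<x+y = mirrorMem-≥ T b 1+b<x+y

  closed : IsNumericalSemigroup S
  closed zero    y       _   y∈S = y∈S
  closed (suc a) zero    x∈S _   = subst (_∈ₙ S) (sym (+-identityʳ (suc a))) x∈S
  closed (suc a) (suc c) x∈S y∈S with mirrorMem-true T b x∈S | mirrorMem-true T b y∈S
  ... | inj₂ 2+b≤x | _          = mirrorMem-≥ T b (≤-trans 2+b≤x (m≤m+n (suc a) (suc c)))
  ... | inj₁ _     | inj₂ 2+b≤y = mirrorMem-≥ T b (≤-trans 2+b≤y (m≤n+m (suc c) (suc a)))
  ... | inj₁ (x≤b , b∸x∈T) | inj₁ (y≤b , b∸y∈T) =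
    -- b ∸ suc a reduces to f ∸ a, so positive summands meet the hypothesis x ≤ F(T) of (b)
    SmallSummands.sum∈S x≤b y≤b b∸x∈T b∸y∈T (m∸n≤m f a) (m∸n≤m f c)

conditions⇒semigroup-complement : ∀ T →
  CondA T × CondB T → Σ NumericalSet λ S → IsNumericalSemigroup S × (T ≐compl S)
conditions⇒semigroup-complement T (condA , condB) = cases (frobenius T) refl
  where
  cases : ∀ m → frobenius T ≡ m → Σ NumericalSet λ S → IsNumericalSemigroup S × (T ≐compl S)
  cases nothing  frobT = T , (λ _ _ _ _ → frobenius-nothing T frobT) , (λ n → sym (complMem-ℕ T n frobT))
  cases (just f) frobT = S , closed , complement
    where open MirrorAtFrobenius {T} frobT condA condB

proposition2p4 : (T : NumericalSet) →
    (Σ NumericalSet λ S → IsNumericalSemigroup S × (T ≐compl S)) ⇔ (CondA T × CondB T)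
proposition2p4 T = mk⇔ (semigroup-complement⇒conditions T) (conditions⇒semigroup-complement T)
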